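{- Let $X$ be an asymmetric graph that is the induced neighbourhood $\langle N(u,Y)\rangle$ of a vertex $u$ of a finite vertex-transitive graph $Y$, and let $S$ be an orbit-restrictor in $X$ with $|S|=p-1$ for a prime $p$. Then for every vertex $v\in S$, $F(X,v)=\bigcap_{w\in S}N(w,X)$.
   Context: All graphs are simple. $N(v,X)$ is the set of neighbours of $v$ in $X$, and $\langle A\rangle$ is the subgraph induced on $A$. A graph is asymmetric if its only automorphism is the identity. $[v]=\{w\in V(X):\langle N(w,X)\rangle\cong\langle N(v,X)\rangle\}$. A clique $S$ in $X$ is an orbit-restrictor if for every $v\in S$: (i) $[v]\subseteq S$; and (ii) for all $v_1,v_2\in[v]$ (not necessarily distinct) and every isomorphism $\phi:\langle N(v_1,X)\rangle\to\langle N(v_2,X)\rangle$, $\phi(S\setminus\{v_1\})=S\setminus\{v_2\}$. A subset $Z\subseteq V(X)$ is a $[v]$-fixed subset if $Z\subseteq\bigcap_{w\in[v]}N(w,X)$ and for all $v_1,v_2\in[v]$ (not necessarily distinct) and every isomorphism $\phi:\langle N(v_1,X)\rangle\to\langle N(v_2,X)\rangle$, $\phi(Z)=Z$. $F(X,v)$ denotes the union of all $[v]$-fixed subsets of $X$ (the largest $[v]$-fixed subset). -}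

module Defs where

open import Data.Bool using (Bool; true; false; T)
open import Data.Fin using (Fin)
open import Data.Nat using (ℕ)
open import Data.Product using (Σ; _×_; _,_; proj₁; proj₂)
open import Relation.Binary.PropositionalEquality using (_≡_; _≢_)
open import Function.Bundles using (_↔_)

record Graph : Set₁ where
  field
    V      : Set
    adj    : V → V → Bool
    sym    : ∀ a b → adj a b ≡ adj b a
    irrefl : ∀ a → adj a a ≡ false
open Graph public

Subset : Graph → Set
Subset G = V G → Bool

Mem : (G : Graph) → V G → Subset G → Set
Mem G x A = T (A x)

Finite : Graph → Set
Finite G = Σ ℕ (λ n → V G ↔ Fin n)

Induced : (G : Graph) → Subset G → Graph
Induced G A = record
  { V      = Σ (V G) (λ x → T (A x))
  ; adj    = λ a b → adj G (proj₁ a) (proj₁ b)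
  ; sym    = λ a b → sym G (proj₁ a) (proj₁ b)
  ; irrefl = λ a → irrefl G (proj₁ a)
  }

N : (G : Graph) → V G → Subset G
N G v = adj G v

Nbhd : (G : Graph) → V G → Graph
Nbhd G v = Induced G (N G v)

record Iso (G H : Graph) : Set where
  field
    to       : V G → V H
    from     : V H → V G
    to-from  : ∀ y → to (from y) ≡ y
    from-to  : ∀ x → from (to x) ≡ x
    adj-pres : ∀ a b → adj H (to a) (to b) ≡ adj G a b
open Iso public

Asymmetric : Graph → Set
Asymmetric G = (f : Iso G G) → ∀ x → to f x ≡ x

VertexTransitive : Graph → Set
VertexTransitive G = ∀ a b → Σ (Iso G G) (λ f → to f a ≡ b)

-- w ∈ [v]  iff  ⟨N(w,G)⟩ ≅ ⟨N(v,G)⟩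
InClass : (G : Graph) → V G → V G → Set
InClass G v w = Iso (Nbhd G w) (Nbhd G v)

-- y ∈ φ(P), for φ : ⟨N(v1)⟩ → ⟨N(v2)⟩ and P a predicate on V G
-- (φ applied to the part of P lying in its domain N(v1)).
InImage : (G : Graph) {v1 v2 : V G} → Iso (Nbhd G v1) (Nbhd G v2) →
          (V G → Set) → V G → Set
InImage G {v1} φ P y =
  Σ (V (Nbhd G v1)) (λ x → P (proj₁ x) × (proj₁ (to φ x) ≡ y))

MapsOnto : (G : Graph) {v1 v2 : V G} → Iso (Nbhd G v1) (Nbhd G v2) →
           (V G → Set) → (V G → Set) → Set
MapsOnto G φ P Q = ∀ y → (InImage G φ P y → Q y) × (Q y → InImage G φ P y)

Minus : (G : Graph) → Subset G → V G → V G → Set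
Minus G S v x = (Mem G x S) × (x ≢ v)

IsClique : (G : Graph) → Subset G → Set
IsClique G S = ∀ a b → Mem G a S → Mem G b S → a ≢ b → T (adj G a b)

OrbitRestrictor : (G : Graph) → Subset G → Set
OrbitRestrictor G S =
  IsClique G S ×
  (∀ v → Mem G v S →
     (∀ w → InClass G v w → Mem G w S) ×
     (∀ v1 v2 → InClass G v v1 → InClass G v v2 →
        (φ : Iso (Nbhd G v1) (Nbhd G v2)) →
        MapsOnto G φ (Minus G S v1) (Minus G S v2)))

FixedSubset : (G : Graph) → V G → Subset G → Set
FixedSubset G v Z =
  (∀ z → Mem G z Z → ∀ w → InClass G v w → T (adj G w z)) ×
  (∀ v1 v2 → InClass G v v1 → InClass G v v2 →
     (φ : Iso (Nbhd G v1) (Nbhd G v2)) →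
     MapsOnto G φ (λ x → Mem G x Z) (λ x → Mem G x Z))

InF : (G : Graph) → V G → V G → Set
InF G v x = Σ (Subset G) (λ Z → FixedSubset G v Z × (Mem G x Z))

{-# OPTIONS --safe #-}
-- Write X = ⟨N(u,Y)⟩ and K = {u} ∪ S, a clique of p vertices of Y. For v ∈ S, vertex
-- transitivity gives an automorphism g of Y with g v = u; it restricts to an isomorphism
-- ψ : ⟨N(v,X)⟩ ≅ ⟨N(g u,X)⟩, so g u ∈ [v] ⊆ S, and as S is an orbit-restrictor g maps K onto K.
-- If a power of g fixes a point of K, conjugating it to an automorphism fixing u and using
-- the asymmetry of X shows that it fixes K pointwise: ⟨g⟩ acts semiregularly on K. As |K| = p
-- is prime and g u ≠ u, the action is transitive, so K consists of the vertices gⁱ u. A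
-- [v]-fixed subset Z satisfies ψ(Z) = Z, hence its vertices are adjacent to every gⁱ u, that
-- is, to all of S. Conversely the common neighbourhood of S is [v]-fixed, because every
-- isomorphism ⟨N(v₁,X)⟩ ≅ ⟨N(v₂,X)⟩ with v₁, v₂ ∈ [v] maps S ∖ {v₁} onto S ∖ {v₂}.

module Submission where

open import Defs hiding (sym)
open import Data.Bool using (Bool; T; if_then_else_)
open import Data.Bool.Properties using (T-irrelevant)
open import Data.Empty using (⊥)
open import Data.Fin using (Fin; zero; suc; toℕ; fromℕ; inject₁)
open import Data.Fin.Properties
  using (_≟_; any?; all?; 0≢1+n; toℕ-injective; toℕ≤pred[n]; toℕ-fromℕ; toℕ-inject₁; pigeonhole; inj⇒≟)
import Data.Fin.Properties as Fin
open import Data.Nat using (ℕ; zero; suc; _+_; _∸_; _≤_; _<_; s≤s; z≤n)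
open import Data.Nat.Divisibility using (_∣_; _∣0; ∣m∣n⇒∣m+n; ∣-refl)
open import Data.Nat.GeneralisedArithmetic using (fold; fold-+)
open import Data.Nat.Induction using (<-rec)
open import Data.Nat.Primality using (Prime; prime⇒irreducible; ¬prime[0])
open import Data.Nat.Properties
  using (+-comm; +-suc; ≤-trans; n≤1+n; 1+n≰n; suc-injective; <-cmp; m≤n⇒∃[o]m+o≡n; m≤n+m; n<1+n)
open import Data.Product using (Σ; ∃; _×_; _,_; proj₁; proj₂; map₂)
open import Data.Sum using (_⊎_; inj₁; inj₂)
open import Function using (_∘_; id; Injective; Injection; Inverse; Equivalence; _↔_; _⇔_; mk⇔)
open import Function.Properties.Inverse using (↔⇒↣)
open import Level using (Level)
open import Relation.Binary.Definitions using (DecidableEquality; tri<; tri≈; tri>)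
open import Relation.Binary.PropositionalEquality
  using (_≡_; _≢_; refl; sym; trans; cong; cong₂; subst; module ≡-Reasoning)
open import Relation.Nullary using (¬_; does; yes; no; contradiction)
open import Relation.Nullary.Decidable using (does-⇔; decidable-stable; T?; toWitness; fromWitness; ⌊_⌋)
open import Relation.Unary using (Pred; Decidable; _⊆_)
open import Relation.Unary.Properties using (∁?; _∩?_; _∪?_; U?)

private
  variable
    a p q : Level
    A : Set a
    n : ℕ
    G H G′ : Graph

count : {P : Pred (Fin n) p} → Decidable P → ℕ
count {zero}  P? = 0
count {suc n} P? = (if does (P? zero) then suc else id) (count (P? ∘ suc))

count-cong : {P : Pred (Fin n) p} {Q : Pred (Fin n) q} (P? : Decidable P) (Q? : Decidable Q) →
             (∀ k → does (P? k) ≡ does (Q? k)) → count P? ≡ count Q?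
count-cong {zero}  P? Q? eq = refl
count-cong {suc n} P? Q? eq =
  cong₂ (λ b c → (if b then suc else id) c) (eq zero) (count-cong (P? ∘ suc) (Q? ∘ suc) (eq ∘ suc))

count-none : {P : Pred (Fin n) p} (P? : Decidable P) → (∀ k → ¬ P k) → count P? ≡ 0
count-none {zero}  P? ∅ = refl
count-none {suc n} P? ∅ with P? zero
... | yes P₀ = contradiction P₀ (∅ zero)
... | no  _  = count-none (P? ∘ suc) (∅ ∘ suc)

count-all : {P : Pred (Fin n) p} (P? : Decidable P) → (∀ k → P k) → count P? ≡ n
count-all {zero}  P? all = refl
count-all {suc n} P? all with P? zero
... | yes _  = cong suc (count-all (P? ∘ suc) (all ∘ suc))
... | no ¬P₀ = contradiction (all zero) ¬P₀

count≤n : {P : Pred (Fin n) p} (P? : Decidable P) → count P? ≤ n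
count≤n {zero}  P? = z≤n
count≤n {suc n} P? with P? zero
... | yes _ = s≤s (count≤n (P? ∘ suc))
... | no  _ = ≤-trans (count≤n (P? ∘ suc)) (n≤1+n n)

count≡n⇒all : {P : Pred (Fin n) p} (P? : Decidable P) → count P? ≡ n → ∀ k → P k
count≡n⇒all {suc n} P? #P≡n k with P? zero | k
... | yes P₀ | zero  = P₀
... | yes _  | suc k = count≡n⇒all (P? ∘ suc) (suc-injective #P≡n) k
... | no  _  | _     = contradiction (subst (_≤ n) #P≡n (count≤n (P? ∘ suc))) 1+n≰n

count-partition : {P : Pred (Fin n) p} {Q : Pred (Fin n) q} (P? : Decidable P) (Q? : Decidable Q) →
                  count P? ≡ count (P? ∩? Q?) + count (P? ∩? ∁? Q?)
count-partition {zero}  P? Q? = refl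
count-partition {suc n} P? Q? with P? zero | Q? zero
... | yes _ | yes _ = cong suc (count-partition (P? ∘ suc) (Q? ∘ suc))
... | yes _ | no  _ = trans (cong suc (count-partition (P? ∘ suc) (Q? ∘ suc))) (sym (+-suc _ _))
... | no  _ | _     = count-partition (P? ∘ suc) (Q? ∘ suc)

count-∩-⊆ : {P : Pred (Fin n) p} {Q : Pred (Fin n) q} (P? : Decidable P) (Q? : Decidable Q) →
            Q ⊆ P → count (P? ∩? Q?) ≡ count Q?
count-∩-⊆ P? Q? Q⊆P =
  count-cong (P? ∩? Q?) Q? (λ k → does-⇔ (mk⇔ proj₂ (λ Qk → Q⊆P Qk , Qk)) ((P? ∩? Q?) k) (Q? k))

count-∪ : {P : Pred (Fin n) p} {Q : Pred (Fin n) q} (P? : Decidable P) (Q? : Decidable Q) →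
          (∀ k → P k → Q k → ⊥) → count (P? ∪? Q?) ≡ count P? + count Q?
count-∪ {zero}  P? Q? disjoint = refl
count-∪ {suc n} P? Q? disjoint with P? zero | Q? zero
... | yes P₀ | yes Q₀ = contradiction Q₀ (disjoint zero P₀)
... | yes _  | no  _  = cong suc (count-∪ (P? ∘ suc) (Q? ∘ suc) (disjoint ∘ suc))
... | no  _  | yes _  = trans (cong suc (count-∪ (P? ∘ suc) (Q? ∘ suc) (disjoint ∘ suc))) (sym (+-suc _ _))
... | no  _  | no  _  = count-∪ (P? ∘ suc) (Q? ∘ suc) (disjoint ∘ suc)

count-singleton : (i : Fin n) → count (i ≟_) ≡ 1
count-singleton {suc n} zero    = cong suc (count-none {n} ((zero ≟_) ∘ suc) (λ _ ()))
count-singleton {suc n} (suc i) = trans (count-cong _ (i ≟_) (λ _ → refl)) (count-singleton i)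

image? : ∀ {m} (f : Fin m → Fin n) → Decidable (λ k → ∃ λ i → f i ≡ k)
image? f k = any? (λ i → f i ≟ k)

count-image : ∀ {m} (f : Fin m → Fin n) → Injective _≡_ _≡_ f → count (image? f) ≡ m
count-image {m = zero}  f f-inj = count-none (image? f) (λ _ ())
count-image {m = suc m} f f-inj = begin
  count (image? f)                                 ≡⟨ count-cong (image? f) _ (λ _ → refl) ⟩
  count ((f zero ≟_) ∪? image? (f ∘ suc))         ≡⟨ count-∪ (f zero ≟_) (image? (f ∘ suc)) disjoint ⟩
  count (f zero ≟_) + count (image? (f ∘ suc))    ≡⟨ cong₂ _+_ (count-singleton (f zero))
                                                               (count-image (f ∘ suc) (Fin.suc-injective ∘ f-inj)) ⟩
  suc m                                            ∎
  where
  open ≡-Reasoning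
  disjoint : ∀ k → f zero ≡ k → (∃ λ i → f (suc i) ≡ k) → ⊥
  disjoint k refl (i , f[1+i]≡f0) = 0≢1+n (f-inj (sym f[1+i]≡f0))

fold-shift : (s : A → A) (x : A) (i j : ℕ) → fold x s (i + j) ≡ fold (fold x s i) s j
fold-shift s x i j = trans (cong (fold x s) (+-comm i j)) (fold-+ x s j)

fold-cycle : (s : A → A) (x : A) {i j : ℕ} → i < j → fold x s i ≡ fold x s j →
             ∃ λ d → i + suc d ≡ j × fold (fold x s i) s (suc d) ≡ fold x s i
fold-cycle s x {i} i<j sᶦx≡sʲx with m≤n⇒∃[o]m+o≡n i<j
... | d , refl = d , +-suc i d , (begin
  fold (fold x s i) s (suc d) ≡⟨ sym (fold-shift s x i (suc d)) ⟩
  fold x s (i + suc d)        ≡⟨ cong (fold x s) (+-suc i d) ⟩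
  fold x s (suc i + d)        ≡⟨ sym sᶦx≡sʲx ⟩
  fold x s i                  ∎)
  where open ≡-Reasoning

least-witness : {P : Pred ℕ p} → Decidable P → ∀ {d} → P d → ∃ λ m → P m × (∀ {j} → j < m → ¬ P j)
least-witness P? {zero}  P₀ = zero , P₀ , λ ()
least-witness P? {suc d} Pd with P? zero
... | yes P₀ = zero , P₀ , λ ()
... | no ¬P₀ with least-witness (P? ∘ suc) Pd
...   | m , Pm , below = suc m , Pm , λ { {zero} _ → ¬P₀ ; {suc j} (s≤s j<m) → below j<m }

module FreeAction {σ : Fin n → Fin n} (m : ℕ)
                  (σ^[1+m]≗id : ∀ k → fold k σ (suc m) ≡ k)
                  (fixed-point-free : ∀ k {j} → j < m → fold k σ (suc j) ≢ k) where

  σ-injective : Injective _≡_ _≡_ σ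
  σ-injective {k} {l} σk≡σl = begin
    k                 ≡⟨ sym (σ^[1+m]≗id k) ⟩
    fold k σ (1 + m)  ≡⟨ fold-shift σ k 1 m ⟩
    fold (σ k) σ m    ≡⟨ cong (λ x → fold x σ m) σk≡σl ⟩
    fold (σ l) σ m    ≡⟨ sym (fold-shift σ l 1 m) ⟩
    fold l σ (1 + m)  ≡⟨ σ^[1+m]≗id l ⟩
    l                 ∎
    where open ≡-Reasoning

  iterates-distinct : ∀ k {i j} → i < j → j ≤ m → fold k σ i ≢ fold k σ j
  iterates-distinct k {i} i<j j≤m σⁱk≡σʲk with fold-cycle σ k i<j σⁱk≡σʲk
  ... | d , refl , cycle = fixed-point-free _ (≤-trans (m≤n+m (suc d) i) j≤m) cycle

  orbit : Fin n → Fin (suc m) → Fin n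
  orbit k i = fold k σ (toℕ i)

  orbit-injective : ∀ k → Injective _≡_ _≡_ (orbit k)
  orbit-injective k {i} {j} eq with <-cmp (toℕ i) (toℕ j)
  ... | tri< i<j _ _ = contradiction eq (iterates-distinct k i<j (toℕ≤pred[n] j))
  ... | tri≈ _ i≡j _ = toℕ-injective i≡j
  ... | tri> _ _ j<i = contradiction (sym eq) (iterates-distinct k j<i (toℕ≤pred[n] i))

  Orbit : Fin n → Pred (Fin n) _
  Orbit k l = ∃ λ i → orbit k i ≡ l

  orbit? : ∀ k → Decidable (Orbit k)
  orbit? k = image? (orbit k)

  orbit-σ⁻¹ : ∀ {k l} → Orbit k (σ l) → Orbit k l
  orbit-σ⁻¹ {k} {l} (zero , k≡σl) = fromℕ m , σ-injective (begin
    σ (fold k σ (toℕ (fromℕ m))) ≡⟨ cong (σ ∘ fold k σ) (toℕ-fromℕ m) ⟩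
    fold k σ (suc m)             ≡⟨ σ^[1+m]≗id k ⟩
    k                            ≡⟨ k≡σl ⟩
    σ l                          ∎)
    where open ≡-Reasoning
  orbit-σ⁻¹ {k} (suc i , σ[σⁱk]≡σl) =
    inject₁ i , trans (cong (fold k σ) (toℕ-inject₁ i)) (σ-injective σ[σⁱk]≡σl)

  Closed : Pred (Fin n) p → Set p
  Closed P = ∀ k → P k → P (σ k)

  closed⇒orbit⊆ : {P : Pred (Fin n) p} → Closed P → ∀ {k} → P k → Orbit k ⊆ P
  closed⇒orbit⊆ {P = P} closed {k} Pk (i , refl) = iterate (toℕ i)
    where
    iterate : ∀ j → P (fold k σ j)
    iterate zero    = Pk
    iterate (suc j) = closed _ (iterate j)

  closed-∖-orbit : {P : Pred (Fin n) p} → Closed P → ∀ k → Closed (λ l → P l × ¬ Orbit k l)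
  closed-∖-orbit closed k l (Pl , l∉Oₖ) = closed l Pl , l∉Oₖ ∘ orbit-σ⁻¹

  -- A closed set is a disjoint union of orbits, each of size 1 + m.
  closed⇒order∣count : {P : Pred (Fin n) p} (P? : Decidable P) → Closed P → suc m ∣ count P?
  closed⇒order∣count {p = p} P? closed = <-rec Goal step (count P?) P? refl closed
    where
    Goal : ℕ → Set (Level.suc p)
    Goal c = ∀ {P : Pred (Fin n) p} (P? : Decidable P) → count P? ≡ c → Closed P → suc m ∣ c
    step : ∀ c → (∀ {c′} → c′ < c → Goal c′) → Goal c
    step _ rec {P} P? refl closed with any? P?
    ... | no ∄P = subst (suc m ∣_) (sym (count-none P? (λ k Pk → ∄P (k , Pk)))) (suc m ∣0)
    ... | yes (k , Pk) = subst (suc m ∣_) (sym split) (∣m∣n⇒∣m+n ∣-refl rest-divisible)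
      where
      open ≡-Reasoning
      rest = count (P? ∩? ∁? (orbit? k))
      split : count P? ≡ suc m + rest
      split = begin
        count P?                      ≡⟨ count-partition P? (orbit? k) ⟩
        count (P? ∩? orbit? k) + rest ≡⟨ cong (_+ rest) (count-∩-⊆ P? (orbit? k) (closed⇒orbit⊆ {P = P} closed Pk)) ⟩
        count (orbit? k) + rest       ≡⟨ cong (_+ rest) (count-image (orbit k) (orbit-injective k)) ⟩
        suc m + rest                  ∎
      smaller : rest < count P?
      smaller = subst (rest <_) (sym split) (s≤s (m≤n+m rest m))
      rest-divisible : suc m ∣ rest
      rest-divisible = rec smaller (P? ∩? ∁? (orbit? k)) refl (closed-∖-orbit closed k)

  order∣n : suc m ∣ n
  order∣n = subst (suc m ∣_) (count-all U? _) (closed⇒order∣count U? (λ _ _ → _))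

  order≡n⇒transitive : suc m ≡ n → ∀ o k → Orbit o k
  order≡n⇒transitive 1+m≡n o =
    count≡n⇒all (orbit? o) (trans (count-image (orbit o) (orbit-injective o)) 1+m≡n)

Semiregular : (A → A) → Set _
Semiregular s = ∀ j {x} → fold x s j ≡ x → ∀ y → fold y s j ≡ y

semiregular⇒free-action : {σ : Fin n → Fin n} → Semiregular σ → Fin n →
  ∃ λ m → (∀ k → fold k σ (suc m) ≡ k) × (∀ k {j} → j < m → fold k σ (suc j) ≢ k)
semiregular⇒free-action {n} {σ} semiregular o
  with i , j , i<j , σⁱo≡σʲo ← pigeonhole (n<1+n n) (λ i → fold o σ (toℕ i))
  with d , _ , cycle ← fold-cycle σ o i<j σⁱo≡σʲo
  with m , σ^[1+m]o≡o , below ← least-witness (λ d → fold o σ (suc d) ≟ o) {d} (semiregular (suc d) cycle o)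
  = m , semiregular (suc m) σ^[1+m]o≡o
  , λ k {j} j<m σ^[1+j]k≡k → below j<m (semiregular (suc j) σ^[1+j]k≡k o)

prime-semiregular⇒transitive : Prime n → {σ : Fin n → Fin n} → Semiregular σ →
                               ∀ o → σ o ≢ o → ∀ k → ∃ λ i → fold o σ i ≡ k
prime-semiregular⇒transitive n-prime {σ} semiregular o σo≢o k
  with m , σ^[1+m]≗id , fixed-point-free ← semiregular⇒free-action semiregular o
  with prime⇒irreducible n-prime (FreeAction.order∣n {σ = σ} m σ^[1+m]≗id fixed-point-free)
... | inj₁ refl  = contradiction (σ^[1+m]≗id o) σo≢o
... | inj₂ 1+m≡n =
  let i , σⁱo≡k = FreeAction.order≡n⇒transitive {σ = σ} m σ^[1+m]≗id fixed-point-free 1+m≡n o k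
  in toℕ i , σⁱo≡k

Iso-refl : Iso G G
Iso-refl = record
  { to = id ; from = id ; to-from = λ _ → refl ; from-to = λ _ → refl ; adj-pres = λ _ _ → refl }

Iso-sym : Iso G H → Iso H G
Iso-sym {G} {H} f = record
  { to = from f ; from = to f ; to-from = from-to f ; from-to = to-from f
  ; adj-pres = λ a b → trans (sym (adj-pres f (from f a) (from f b)))
                             (cong₂ (adj H) (to-from f a) (to-from f b)) }

Iso-trans : Iso G H → Iso H G′ → Iso G G′
Iso-trans f g = record
  { to       = to g ∘ to f
  ; from     = from f ∘ from g
  ; to-from  = λ z → trans (cong (to g) (to-from f (from g z))) (to-from g z)
  ; from-to  = λ x → trans (cong (from f) (from-to g (to f x))) (from-to f x)
  ; adj-pres = λ a b → trans (adj-pres g (to f a) (to f b)) (adj-pres f a b) }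

to-injective : (f : Iso G H) → Injective _≡_ _≡_ (to f)
to-injective f {x} {y} fx≡fy = trans (sym (from-to f x)) (trans (cong (from f) fx≡fy) (from-to f y))

Iso-pow : Iso G G → ℕ → Iso G G
Iso-pow f zero    = Iso-refl
Iso-pow f (suc j) = Iso-trans (Iso-pow f j) f

to-Iso-pow : (f : Iso G G) (j : ℕ) (x : V G) → to (Iso-pow f j) x ≡ fold x (to f) j
to-Iso-pow f zero    x = refl
to-Iso-pow f (suc j) x = cong (to f) (to-Iso-pow f j x)

induced-≡ : {W : Set} {A : W → Bool} {x y : Σ W (T ∘ A)} → proj₁ x ≡ proj₁ y → x ≡ y
induced-≡ {x = x , s} {y = .x , t} refl = cong (x ,_) (T-irrelevant s t)

Iso-restrict : (f : Iso G H) {A : Subset G} {B : Subset H} →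
               (∀ x → B (to f x) ≡ A x) → Iso (Induced G A) (Induced H B)
Iso-restrict f {A} {B} B∘f≗A = record
  { to       = λ (x , a) → to f x , subst T (sym (B∘f≗A x)) a
  ; from     = λ (y , b) → from f y , subst T (trans (cong B (sym (to-from f y))) (B∘f≗A (from f y))) b
  ; to-from  = λ (y , _) → induced-≡ (to-from f y)
  ; from-to  = λ (x , _) → induced-≡ (from-to f x)
  ; adj-pres = λ (x , _) (y , _) → adj-pres f x y }

induced-swap : (A B : Subset G) →
               Iso (Induced (Induced G A) (B ∘ proj₁)) (Induced (Induced G B) (A ∘ proj₁))
induced-swap A B = record
  { to       = λ ((x , a) , b) → (x , b) , a
  ; from     = λ ((x , b) , a) → (x , a) , b
  ; to-from  = λ _ → refl
  ; from-to  = λ _ → refl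
  ; adj-pres = λ _ _ → refl }

N-to : (f : Iso G H) {x : V G} {x′ : V H} → to f x ≡ x′ → ∀ y → N H x′ (to f y) ≡ N G x y
N-to f refl = adj-pres f _

adj-sym : {a b : V G} → T (adj G a b) → T (adj G b a)
adj-sym {G} {a} {b} = subst T (Graph.sym G a b)

adj⇒≢ : {a b : V G} → T (adj G a b) → a ≢ b
adj⇒≢ {G} {a} t refl = subst T (irrefl G a) t

CommonNbhd : (G : Graph) → Subset G → V G → Set
CommonNbhd G S y = ∀ w → Mem G w S → T (adj G w y)

common-nbhd : (G : Graph) (S : Subset G) {q : ℕ} → Fin q ↔ Σ (V G) (λ w → Mem G w S) → Subset G
common-nbhd G S e y = ⌊ all? (λ i → T? (adj G (proj₁ (Inverse.to e i)) y)) ⌋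

common-nbhd-spec : (G : Graph) (S : Subset G) {q : ℕ} (e : Fin q ↔ Σ (V G) (λ w → Mem G w S)) →
                   ∀ y → Mem G y (common-nbhd G S e) ⇔ CommonNbhd G S y
common-nbhd-spec G S e y = mk⇔
  (λ y∈Z w w∈S → subst (λ (w′ , _) → T (adj G w′ y)) (Inverse.strictlyInverseˡ e (w , w∈S))
                       (toWitness y∈Z (Inverse.from e (w , w∈S))))
  (λ y∈∩N → fromWitness (λ i → y∈∩N _ (proj₂ (Inverse.to e i))))

module Restrictor {G : Graph} {S : Subset G} (restrictor : OrbitRestrictor G S) where

  clique : IsClique G S
  clique = proj₁ restrictor

  class⊆S : ∀ {v} → Mem G v S → ∀ w → InClass G v w → Mem G w S
  class⊆S v∈S = proj₁ (proj₂ restrictor _ v∈S)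

  restricts : ∀ {v} → Mem G v S → ∀ v₁ v₂ → InClass G v v₁ → InClass G v v₂ →
              (φ : Iso (Nbhd G v₁) (Nbhd G v₂)) → MapsOnto G φ (Minus G S v₁) (Minus G S v₂)
  restricts v∈S = proj₂ (proj₂ restrictor _ v∈S)

  -- If w ≁ φ a then w ≠ v₂, so w = φ s for some s ∈ S ∖ {v₁}; but s ~ a.
  iso-preserves-common-nbhd : ∀ {v v₁ v₂} → Mem G v S → InClass G v v₁ → InClass G v v₂ →
                              (φ : Iso (Nbhd G v₁) (Nbhd G v₂)) →
                              ∀ a → CommonNbhd G S (proj₁ a) → CommonNbhd G S (proj₁ (to φ a))
  iso-preserves-common-nbhd {v₂ = v₂} v∈S c₁ c₂ φ a a∈∩N w w∈S = decidable-stable (T? _) λ ¬w~φa →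
    let w≢v₂ = λ w≡v₂ → ¬w~φa (subst (λ w → T (adj G w (proj₁ (to φ a)))) (sym w≡v₂) (proj₂ (to φ a)))
        (s , (s∈S , _) , φs≡w) = proj₂ (restricts v∈S _ _ c₁ c₂ φ w) (w∈S , w≢v₂)
    in ¬w~φa (subst (λ w → T (adj G w (proj₁ (to φ a)))) φs≡w
                    (subst T (sym (adj-pres φ s a)) (a∈∩N (proj₁ s) s∈S)))

  common-nbhd-fixed : ∀ {v} → Mem G v S → (Z : Subset G) → (∀ y → Mem G y Z ⇔ CommonNbhd G S y) →
                      FixedSubset G v Z
  common-nbhd-fixed v∈S Z Z≡∩N =
      (λ z z∈Z w c → Equivalence.to (Z≡∩N z) z∈Z w (class⊆S v∈S w c))
    , λ v₁ v₂ c₁ c₂ φ y →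
        (λ (a , a∈Z , φa≡y) → Equivalence.from (Z≡∩N y) (subst (CommonNbhd G S) φa≡y
           (iso-preserves-common-nbhd v∈S c₁ c₂ φ a (Equivalence.to (Z≡∩N _) a∈Z))))
      , λ y∈Z →
          let y∈∩N = Equivalence.to (Z≡∩N y) y∈Z
              y′   = y , y∈∩N v₂ (class⊆S v∈S v₂ c₂)
          in from φ y′
           , Equivalence.from (Z≡∩N _) (iso-preserves-common-nbhd v∈S c₂ c₁ (Iso-sym φ) y′ y∈∩N)
           , cong proj₁ (to-from φ y′)

module Link (Y : Graph) (_≟ᵥ_ : DecidableEquality (V Y)) (u : V Y)
            {S : Subset (Nbhd Y u)} (restrictor : OrbitRestrictor (Nbhd Y u) S) where

  X : Graph
  X = Nbhd Y u

  open Restrictor restrictor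

  -- Swapping the two membership proofs turns ⟨N(w,X)⟩ = ⟨N(u) ∩ N(w)⟩ into ⟨N(w) ∩ N(u)⟩,
  -- which h maps onto ⟨N(u) ∩ N(h u)⟩ = ⟨N(h u,X)⟩.
  nbhd-iso : (h : Iso Y Y) {w b : V X} → to h (proj₁ w) ≡ u → to h u ≡ proj₁ b →
             Iso (Nbhd X w) (Nbhd X b)
  nbhd-iso h {w} hw≡u hu≡b = Iso-trans (induced-swap (N Y u) (N Y (proj₁ w)))
                                       (Iso-restrict (Iso-restrict h (N-to h hw≡u)) (N-to h hu≡b ∘ proj₁))

  asymmetric⇒fixes-link : Asymmetric X → (c : Iso Y Y) → to c u ≡ u → (x : V X) → to c (proj₁ x) ≡ proj₁ x
  asymmetric⇒fixes-link asym c cu≡u x = cong proj₁ (asym (Iso-restrict c (N-to c cu≡u)) x)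

  module Sending (h : Iso Y Y) (w : V X) (hw≡u : to h (proj₁ w) ≡ u) where

    hu-adj : T (adj Y u (to h u))
    hu-adj = subst T (sym (N-to h hw≡u u)) (adj-sym {Y} (proj₂ w))

    hu : V X
    hu = to h u , hu-adj

    ψ : Iso (Nbhd X w) (Nbhd X hu)
    ψ = nbhd-iso h {w} {hu} hw≡u refl

    -- ψ acts as h and Z = ψ(Z), so adjacency to hⁱ u passes to hⁱ⁺¹ u.
    fixed⇒adj-iterates : ∀ {Z} → FixedSubset X w Z → ∀ {z} → Mem X z Z →
                         ∀ i → T (adj Y (proj₁ z) (fold u (to h) i))
    fixed⇒adj-iterates Z-fixed {z} z∈Z zero    = adj-sym {Y} (proj₂ z)
    fixed⇒adj-iterates Z-fixed {z} z∈Z (suc i)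
      with a , a∈Z , refl ← proj₂ (proj₂ Z-fixed w hu Iso-refl (Iso-sym ψ) ψ _) z∈Z
      = subst T (sym (adj-pres h _ _)) (fixed⇒adj-iterates Z-fixed a∈Z i)

  K : V Y → Set
  K y = y ≡ u ⊎ Σ (T (adj Y u y)) (λ t → Mem X (y , t) S)

  K-preserved : (h : Iso Y Y) (w : V X) → Mem X w S → to h (proj₁ w) ≡ u → ∀ {y} → K y → K (to h y)
  K-preserved h w w∈S hw≡u (inj₁ refl) = inj₂ (hu-adj , class⊆S w∈S hu (Iso-sym ψ))
    where open Sending h w hw≡u
  K-preserved h w w∈S hw≡u {y} (inj₂ (t , y∈S)) with y ≟ᵥ proj₁ w
  ... | yes refl = inj₁ hw≡u
  ... | no  y≢w  = inj₂ (hy-adj , proj₁ (proj₁ (restricts w∈S w hu Iso-refl (Iso-sym ψ) ψ _) hy∈ψ[S∖w]))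
    where
    open Sending h w hw≡u
    y′ : V (Nbhd X w)
    y′ = (y , t) , clique w (y , t) w∈S y∈S (λ w≡y → y≢w (cong proj₁ (sym w≡y)))
    hy-adj : T (adj Y u (to h y))
    hy-adj = subst T (sym (N-to h hw≡u y)) (proj₂ y′)
    hy∈ψ[S∖w] : InImage X {w} {hu} ψ (Minus X S w) (to h y , hy-adj)
    hy∈ψ[S∖w] = y′ , (y∈S , y≢w ∘ cong proj₁) , refl

  K-to-u : VertexTransitive Y → ∀ {y} → K y → Σ (Iso Y Y) λ h → to h y ≡ u × (∀ {z} → K z → K (to h z))
  K-to-u vt (inj₁ refl) = Iso-refl , refl , id
  K-to-u vt {y} (inj₂ (t , y∈S)) = let h , hy≡u = vt y u in h , hy≡u , K-preserved h (y , t) y∈S hy≡u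

  fixes-u⇒fixes-K : Asymmetric X → (c : Iso Y Y) → to c u ≡ u → ∀ {z} → K z → to c z ≡ z
  fixes-u⇒fixes-K asym c cu≡u (inj₁ refl)    = cu≡u
  fixes-u⇒fixes-K asym c cu≡u (inj₂ (t , _)) = asymmetric⇒fixes-link asym c cu≡u (_ , t)

  -- Conjugating f by some h with h y = u that preserves K gives an automorphism fixing u.
  fixes-point⇒fixes-K : VertexTransitive Y → Asymmetric X → (f : Iso Y Y) →
                        ∀ {y} → K y → to f y ≡ y → ∀ {z} → K z → to f z ≡ z
  fixes-point⇒fixes-K vt asym f {y} y∈K fy≡y {z} z∈K with h , hy≡u , h-preserves ← K-to-u vt y∈K =
    to-injective h (begin
      to h (to f z)         ≡⟨ cong (to h ∘ to f) (sym (from-to h z)) ⟩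
      to fʰ (to h z)        ≡⟨ fixes-u⇒fixes-K asym fʰ fʰu≡u (h-preserves z∈K) ⟩
      to h z                ∎)
    where
    open ≡-Reasoning
    fʰ : Iso Y Y
    fʰ = Iso-trans (Iso-trans (Iso-sym h) f) h
    fʰu≡u : to fʰ u ≡ u
    fʰu≡u = begin
      to h (to f (from h u))         ≡⟨ cong (to h ∘ to f ∘ from h) (sym hy≡u) ⟩
      to h (to f (from h (to h y)))  ≡⟨ cong (to h ∘ to f) (from-to h y) ⟩
      to h (to f y)                  ≡⟨ cong (to h) fy≡y ⟩
      to h y                         ≡⟨ hy≡u ⟩
      u                              ∎

  module Indexed {q : ℕ} (e : Fin q ↔ Σ (V X) (λ x → Mem X x S)) where
    open Inverse e using () renaming (to to enum; from to enum⁻¹; strictlyInverseˡ to enum∘enum⁻¹)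

    ι : Fin (suc q) → V Y
    ι zero    = u
    ι (suc i) = proj₁ (proj₁ (enum i))

    ι-K : ∀ k → K (ι k)
    ι-K zero    = inj₁ refl
    ι-K (suc i) = inj₂ (proj₂ (proj₁ (enum i)) , proj₂ (enum i))

    ι-injective : Injective _≡_ _≡_ ι
    ι-injective {zero}  {zero}  _      = refl
    ι-injective {zero}  {suc j} u≡ιj   = contradiction u≡ιj (adj⇒≢ {Y} (proj₂ (proj₁ (enum j))))
    ι-injective {suc i} {zero}  ιi≡u   = contradiction (sym ιi≡u) (adj⇒≢ {Y} (proj₂ (proj₁ (enum i))))
    ι-injective {suc i} {suc j} ιi≡ιj = cong suc (Injection.injective (↔⇒↣ e) (induced-≡ (induced-≡ ιi≡ιj)))

    index : ∀ {y} → K y → Fin (suc q)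
    index     (inj₁ _)         = zero
    index {y} (inj₂ (t , y∈S)) = suc (enum⁻¹ ((y , t) , y∈S))

    ι-index : ∀ {y} (y∈K : K y) → ι (index y∈K) ≡ y
    ι-index (inj₁ refl)      = refl
    ι-index (inj₂ (t , y∈S)) = cong (proj₁ ∘ proj₁) (enum∘enum⁻¹ _)

    module Transport (g : Iso Y Y) (g-preserves : ∀ {y} → K y → K (to g y)) where

      σ : Fin (suc q) → Fin (suc q)
      σ k = index (g-preserves (ι-K k))

      ι-σ : ∀ k → ι (σ k) ≡ to g (ι k)
      ι-σ k = ι-index (g-preserves (ι-K k))

      ι-fold : ∀ k j → ι (fold k σ j) ≡ fold (ι k) (to g) j
      ι-fold k zero    = refl
      ι-fold k (suc j) = trans (ι-σ (fold k σ j)) (cong (to g) (ι-fold k j))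

      σ-semiregular : VertexTransitive Y → Asymmetric X → Semiregular σ
      σ-semiregular vt asym j {k} σʲk≡k k′ = ι-injective (begin
        ι (fold k′ σ j)          ≡⟨ ι-fold k′ j ⟩
        fold (ι k′) (to g) j     ≡⟨ sym (to-Iso-pow g j (ι k′)) ⟩
        to (Iso-pow g j) (ι k′)  ≡⟨ fixes-point⇒fixes-K vt asym (Iso-pow g j) (ι-K k) gʲιk≡ιk (ι-K k′) ⟩
        ι k′                     ∎)
        where
        open ≡-Reasoning
        gʲιk≡ιk : to (Iso-pow g j) (ι k) ≡ ι k
        gʲιk≡ιk = begin
          to (Iso-pow g j) (ι k) ≡⟨ to-Iso-pow g j (ι k) ⟩
          fold (ι k) (to g) j    ≡⟨ sym (ι-fold k j) ⟩
          ι (fold k σ j)         ≡⟨ cong ι σʲk≡k ⟩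
          ι k                    ∎

      transitive-on-K : VertexTransitive Y → Asymmetric X → Prime (suc q) → to g u ≢ u →
                        ∀ {y} → K y → ∃ λ i → fold u (to g) i ≡ y
      transitive-on-K vt asym p-prime gu≢u y∈K =
        map₂ (λ {i} σⁱ0≡y → trans (sym (ι-fold zero i)) (trans (cong ι σⁱ0≡y) (ι-index y∈K)))
             (prime-semiregular⇒transitive p-prime (σ-semiregular vt asym) zero σ0≢0 (index y∈K))
        where
        σ0≢0 : σ zero ≢ zero
        σ0≢0 = gu≢u ∘ trans (sym (ι-σ zero)) ∘ cong ι

    fixed⊆common-nbhd : VertexTransitive Y → Asymmetric X → Prime (suc q) → ∀ {v} → Mem X v S →
                        ∀ {Z} → FixedSubset X v Z → ∀ {x} → Mem X x Z → CommonNbhd X S x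
    fixed⊆common-nbhd vt asym p-prime {v} v∈S Z-fixed {x} x∈Z w w∈S =
      let g , gv≡u  = vt (proj₁ v) u
          i , gⁱu≡w = Transport.transitive-on-K g (K-preserved g v v∈S gv≡u) vt asym p-prime
                        (adj⇒≢ {Y} (Sending.hu-adj g v gv≡u) ∘ sym) (inj₂ (proj₂ w , w∈S))
      in adj-sym {Y} (subst (T ∘ adj Y (proj₁ x)) gⁱu≡w
                            (Sending.fixed⇒adj-iterates g v gv≡u Z-fixed x∈Z i))

proposition2p11 : (Y : Graph) → Finite Y → VertexTransitive Y → (u : V Y) →
    Asymmetric (Nbhd Y u) →
    (S : Subset (Nbhd Y u)) → OrbitRestrictor (Nbhd Y u) S →
    (p : ℕ) → Prime p → (Fin (p ∸ 1) ↔ Σ (V (Nbhd Y u)) (λ x → Mem (Nbhd Y u) x S)) →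
    ∀ v → Mem (Nbhd Y u) v S → ∀ x →
      InF (Nbhd Y u) v x ⇔ (∀ w → Mem (Nbhd Y u) w S → T (adj (Nbhd Y u) w x))
proposition2p11 Y finite vt u asym S restrictor zero    p-prime e v v∈S x = contradiction p-prime ¬prime[0]
proposition2p11 Y finite vt u asym S restrictor (suc q) p-prime e v v∈S x =
  mk⇔ (λ (Z , Z-fixed , x∈Z) → fixed⊆common-nbhd vt asym p-prime v∈S Z-fixed x∈Z)
      (λ x∈∩N → ∩N , common-nbhd-fixed v∈S ∩N (common-nbhd-spec X S e)
                   , Equivalence.from (common-nbhd-spec X S e x) x∈∩N)
  where
  open Link Y (inj⇒≟ (↔⇒↣ (proj₂ finite))) u restrictor
  open Indexed e
  open Restrictor restrictor
  ∩N : Subset X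
  ∩N = common-nbhd X S e
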